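{- Let $\mathbf{b}=(b_1,\dots,b_d)\in\mathbb{Z}_{>0}^d$, $\beta=\frac12\sum_{i=1}^d b_i$, and $$P_{\mathbf{b}}=[0,1]^{d+2}\cap\Big\{\mathbf{x}\in\mathbb{R}^{d+2}:\sum_{i=1}^d b_ix_i-\beta x_{d+1}+(\beta+\tfrac12)x_{d+2}\le\beta+\tfrac14\Big\}.$$ Then the combinatorial diameter of $P_{\mathbf{b}}$ is at most $2(d+2)$.
   Context: The combinatorial diameter of a polytope is the diameter of its vertex–edge graph.
   Formalization: The polytope $P_{\mathbf{b}}$ is taken in ℚ^(d+2) rather than $\mathbb{R}^{d+2}$, and the supporting inequalities defining its vertices and edges have rational coefficients and right-hand sides. -}

module Defs where

open import Data.Nat as ℕ using (ℕ; zero; suc)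
open import Data.Integer using (+_)
open import Data.Rational using (ℚ; 0ℚ; 1ℚ; ½; _/_; _+_; _-_; _*_; _≤_)
open import Data.Fin using (Fin; zero; suc; _↑ˡ_; _↑ʳ_)
open import Data.Product using (Σ; _×_; ∃)
open import Relation.Binary.PropositionalEquality using (_≡_; _≗_)
open import Relation.Nullary using (¬_)

Point : ℕ → Set
Point n = Fin n → ℚ

Σℚ : ∀ {n} → (Fin n → ℚ) → ℚ
Σℚ {zero}  f = 0ℚ
Σℚ {suc n} f = f zero + Σℚ (λ i → f (suc i))

dot : ∀ {n} → Point n → Point n → ℚ
dot c x = Σℚ (λ i → c i * x i)

ℕ→ℚ : ℕ → ℚ
ℕ→ℚ k = + k / 1

Valid : ∀ {n} → (Point n → Set) → Point n → ℚ → Set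
Valid P c δ = ∀ x → P x → dot c x ≤ δ

IsVertex : ∀ {n} → (Point n → Set) → Point n → Set
IsVertex P v =
  P v × Σ (Point _) λ c → Σ ℚ λ δ →
    Valid P c δ × dot c v ≡ δ × (∀ x → P x → dot c x ≡ δ → x ≗ v)

OnSegment : ∀ {n} → Point n → Point n → Point n → Set
OnSegment u v x = Σ ℚ λ t → (0ℚ ≤ t) × (t ≤ 1ℚ) ×
  (∀ i → x i ≡ t * u i + (1ℚ - t) * v i)

IsEdge : ∀ {n} → (Point n → Set) → Point n → Point n → Set
IsEdge P u v =
  IsVertex P u × IsVertex P v × ¬ (u ≗ v) ×
  Σ (Point _) λ c → Σ ℚ λ δ →
    Valid P c δ × dot c u ≡ δ × dot c v ≡ δ ×
    (∀ x → P x → dot c x ≡ δ → OnSegment u v x)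

data Walk {n} (P : Point n → Set) : Point n → Point n → ℕ → Set where
  stop : ∀ {u v} → u ≗ v → Walk P u v 0
  step : ∀ {u w v k} → IsEdge P u w → Walk P w v k → Walk P u v (suc k)

DiameterAtMost : ∀ {n} → (Point n → Set) → ℕ → Set
DiameterAtMost P k =
  ∀ u v → IsVertex P u → IsVertex P v →
    Σ ℕ λ m → (m ℕ.≤ k) × Walk P u v m

β : ∀ {d} → (Fin d → ℕ) → ℚ
β b = ½ * Σℚ (λ i → ℕ→ℚ (b i))

-- x_{d+1} and x_{d+2} (coordinates d and d+1 in 0-based indexing)
idx₁ : ∀ d → Fin (d ℕ.+ 2)
idx₁ d = d ↑ʳ zero

idx₂ : ∀ d → Fin (d ℕ.+ 2)
idx₂ d = d ↑ʳ suc zero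

Pb : ∀ {d} → (Fin d → ℕ) → Point (d ℕ.+ 2) → Set
Pb {d} b x =
  (∀ i → (0ℚ ≤ x i) × (x i ≤ 1ℚ)) ×
  ((Σℚ (λ i → ℕ→ℚ (b i) * x (i ↑ˡ 2)) - β b * x (idx₁ d))
     + (β b + ½) * x (idx₂ d)
   ≤ β b + (+ 1 / 4))

-- Every vertex u of a knapsack polytope K = {x ∈ [0,1]ⁿ : a·x ≤ r} is either a 0/1 point or
-- has exactly one fractional coordinate j, with a_j ≠ 0 and a·u = r: otherwise a small
-- perturbation along one or two coordinates would stay inside K in both directions,
-- exhibiting u as a midpoint.  If r ≥ 0, a 0/1 point of K walks to the origin along cube edges,
-- dropping one coordinate per step and staying in K (drop one with a nonnegative coefficient;
-- if there is none, all terms of a·x are nonpositive).  A fractional vertex is adjacent to the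
-- 0/1 point obtained by rounding u_j in the direction that decreases a·x; when the all-ones
-- point is cut off, that point has at most n − 1 ones.  Hence every vertex is within n steps of
-- the origin and the diameter is at most 2n.  P_b is such a polytope with n = d + 2.
module Submission where

open import Defs
open import Data.Fin using (Fin)

module KnapsackPolytopes where
  open import Algebra.Properties.CommutativeMonoid.Sum using (sum; ∑-distrib-+)
  open import Data.Bool using (Bool; true; false)
  open import Data.Empty using (⊥; ⊥-elim)
  open import Data.Fin using (zero; suc; _↑ˡ_; _↑ʳ_)
  open import Data.Fin.Properties using (any?; suc-injective) renaming (_≟_ to _≟ᶠ_)
  open import Data.Fin.Subset using (Subset; _∈_; _∉_; _⊆_; _⊂_; Nonempty; outside)
    renaming (∣_∣ to ∣_∣ˢ; ⊥ to ∅)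
  open import Data.Fin.Subset.Properties
    using (_∈?_; nonempty?; Empty-unique; p⊂q⇒∣p∣<∣q∣; ∣p∣≤n; ∣p∣≡n⇒p≡⊤)
  import Data.Integer as ℤ
  open import Data.Maybe using (Maybe; just; nothing)
  open import Data.Maybe.Relation.Unary.All using (All; just; nothing; drop-just)
  open import Data.Nat as ℕ using (ℕ; zero; suc)
  open import Data.Nat.Induction using (<-wellFounded)
  import Data.Nat.Properties as ℕ
  open import Data.Product using (∃-syntax; _×_; _,_; proj₁; proj₂)
  open import Data.Rational
    using ( ℚ; 0ℚ; 1ℚ; ½; _/_; _+_; _*_; _-_; -_; ∣_∣; 1/_; _⊓_; _⊔_; _≤_; _<_; _≤?_; _<?_
          ; Positive; positive; nonNegative; nonPositive; negative)
  open import Data.Rational.Properties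
  open import Data.Rational.Solver using (module +-*-Solver)
  open import Data.Sum using (inj₁; inj₂)
  open import Data.Vec using (lookup; tabulate; _[_]≔_)
  open import Data.Vec.Properties
    using (lookup∘update; lookup∘update′; []=⇒lookup; lookup⇒[]=; lookup∘tabulate; lookup-replicate)
  open import Data.Vec.Functional using (updateAt; _++_; _∷_; [])
  open import Data.Vec.Functional.Properties
    using (updateAt-updates; updateAt-minimal; lookup-++ˡ; lookup-++ʳ)
  open import Function using (_∘_; _$_; _⇔_; Equivalence; mk⇔)
  import Function.Properties.Equivalence as ⇔
  open import Induction.WellFounded using (Acc; acc)
  open import Relation.Binary.Definitions using (_Respects_)
  open import Relation.Binary.PropositionalEquality
  open import Relation.Nullary using (¬_; Dec; yes; no; does; contradiction)
  open import Relation.Nullary.Decidable using (_×-dec_)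
  open +-*-Solver using (solve; _:=_; _:+_; _:*_; _:-_; :-_; con)

  ≤∧≢⇒< : ∀ {p q} → p ≤ q → p ≢ q → p < q
  ≤∧≢⇒< {p} {q} p≤q p≢q with p <? q
  ... | yes p<q = p<q
  ... | no  p≮q = contradiction (≤-antisym p≤q (≮⇒≥ p≮q)) p≢q

  p≤q⇒0≤q-p : ∀ {p q} → p ≤ q → 0ℚ ≤ q - p
  p≤q⇒0≤q-p {p} p≤q = ≤-trans (≤-reflexive (sym (+-inverseʳ p))) (+-monoˡ-≤ (- p) p≤q)

  p<q⇒0<q-p : ∀ {p q} → p < q → 0ℚ < q - p
  p<q⇒0<q-p {p} p<q = ≤-<-trans (≤-reflexive (sym (+-inverseʳ p))) (+-monoˡ-< (- p) p<q)

  +-≤-≡⇒≡ˡ : ∀ {a b c d} → a ≤ b → c ≤ d → a + c ≡ b + d → a ≡ b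
  +-≤-≡⇒≡ˡ a≤b c≤d eq = ≤-antisym a≤b (≮⇒≥ (λ a<b → <⇒≢ (+-mono-<-≤ a<b c≤d) eq))

  +-cancelˡ-≤ : ∀ r {p q} → r + p ≤ r + q → p ≤ q
  +-cancelˡ-≤ r {p} {q} r+p≤r+q = begin
    p             ≡⟨ cancel p ⟩
    - r + (r + p) ≤⟨ +-monoʳ-≤ (- r) r+p≤r+q ⟩
    - r + (r + q) ≡⟨ cancel q ⟨
    q             ∎
    where
    open ≤-Reasoning
    cancel : ∀ x → x ≡ - r + (r + x)
    cancel = solve 2 (λ r x → x := :- r :+ (r :+ x)) refl r

  p≤∣p∣ : ∀ p → p ≤ ∣ p ∣
  p≤∣p∣ p with ≤-total 0ℚ p
  ... | inj₁ 0≤p = ≤-reflexive (sym (0≤p⇒∣p∣≡p 0≤p))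
  ... | inj₂ p≤0 = ≤-trans p≤0 (0≤∣p∣ p)

  -∣p∣≤p : ∀ p → - ∣ p ∣ ≤ p
  -∣p∣≤p p = begin
    - ∣ p ∣     ≡⟨ cong -_ (∣-p∣≡∣p∣ p) ⟨
    - ∣ - p ∣   ≤⟨ neg-antimono-≤ (p≤∣p∣ (- p)) ⟩
    - (- p)     ≡⟨ solve 1 (λ p → :- (:- p) := p) refl p ⟩
    p           ∎
    where open ≤-Reasoning

  ∣q∣≤r-p⇒p+q≤r : ∀ {p q r} → ∣ q ∣ ≤ r - p → p + q ≤ r
  ∣q∣≤r-p⇒p+q≤r {p} {q} {r} ∣q∣≤r-p = begin
    p + q       ≤⟨ +-monoʳ-≤ p (p≤∣p∣ q) ⟩
    p + ∣ q ∣   ≤⟨ +-monoʳ-≤ p ∣q∣≤r-p ⟩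
    p + (r - p) ≡⟨ solve 2 (λ p r → p :+ (r :- p) := r) refl p r ⟩
    r           ∎
    where open ≤-Reasoning

  ⊓-glb-< : ∀ {p q r} → r < p → r < q → r < p ⊓ q
  ⊓-glb-< {p} {q} {r} r<p r<q with ⊓-sel p q
  ... | inj₁ p⊓q≡p = subst (r <_) (sym p⊓q≡p) r<p
  ... | inj₂ p⊓q≡q = subst (r <_) (sym p⊓q≡q) r<q

  *-≡0-pos : ∀ {p t} → 0ℚ < t → p * t ≡ 0ℚ → p ≡ 0ℚ
  *-≡0-pos {p} {t} 0<t pt≡0 = ≤-antisym
    (*-cancelʳ-≤-pos t {{positive 0<t}} (≤-reflexive (trans pt≡0 (sym (*-zeroˡ t)))))
    (*-cancelʳ-≤-pos t {{positive 0<t}} (≤-reflexive (trans (*-zeroˡ t) (sym pt≡0))))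

  small-multiplier : ∀ {ε} → 0ℚ < ε → ∀ S →
    ∃[ t ] 0ℚ < t × t ≤ ε × (∀ g → ∣ g ∣ ≤ S → ∣ g * t ∣ ≤ ε)
  small-multiplier {ε} 0<ε S = t , 0<t , t≤ε , λ g ∣g∣≤S → bound g (≤-trans ∣g∣≤S S≤S⁺)
    where
    open ≤-Reasoning
    S⁺ : ℚ
    S⁺ = ∣ S ∣ + 1ℚ
    instance
      S⁺-positive : Positive S⁺
      S⁺-positive = positive (+-mono-≤-< (0≤∣p∣ S) (positive⁻¹ 1ℚ))
      ε-positive : Positive ε
      ε-positive = positive 0<ε
    S≤S⁺ : S ≤ S⁺
    S≤S⁺ = begin
      S            ≤⟨ p≤∣p∣ S ⟩
      ∣ S ∣        ≡⟨ +-identityʳ ∣ S ∣ ⟨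
      ∣ S ∣ + 0ℚ   ≤⟨ +-monoʳ-≤ ∣ S ∣ (nonNegative⁻¹ 1ℚ) ⟩
      S⁺           ∎
    t : ℚ
    t = ε * (1/ S⁺) {{pos⇒nonZero S⁺}}
    0<t : 0ℚ < t
    0<t = positive⁻¹ t {{pos*pos⇒pos ε _ {{1/pos⇒pos S⁺}}}}
    bound : ∀ g → ∣ g ∣ ≤ S⁺ → ∣ g * t ∣ ≤ ε
    bound g ∣g∣≤S⁺ = begin
      ∣ g * t ∣      ≡⟨ ∣p*q∣≡∣p∣*∣q∣ g t ⟩
      ∣ g ∣ * ∣ t ∣  ≡⟨ cong (∣ g ∣ *_) (0≤p⇒∣p∣≡p (<⇒≤ 0<t)) ⟩
      ∣ g ∣ * t      ≤⟨ *-monoʳ-≤-nonNeg t {{pos⇒nonNeg t {{positive 0<t}}}} ∣g∣≤S⁺ ⟩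
      S⁺ * t         ≡⟨ solve 3 (λ s e i → s :* (e :* i) := e :* (s :* i)) refl S⁺ ε _ ⟩
      ε * (S⁺ * _)   ≡⟨ cong (ε *_) (*-inverseʳ S⁺ {{pos⇒nonZero S⁺}}) ⟩
      ε * 1ℚ         ≡⟨ *-identityʳ ε ⟩
      ε              ∎
    t≤ε : t ≤ ε
    t≤ε = begin
      t           ≤⟨ p≤∣p∣ t ⟩
      ∣ t ∣       ≡⟨ cong ∣_∣ (*-identityˡ t) ⟨
      ∣ 1ℚ * t ∣  ≤⟨ bound 1ℚ (+-mono-≤ (0≤∣p∣ S) ≤-refl) ⟩
      ε           ∎

  Σℚ≡sum : ∀ {n} (f : Fin n → ℚ) → Σℚ f ≡ sum +-0-commutativeMonoid f
  Σℚ≡sum {zero}  f = refl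
  Σℚ≡sum {suc n} f = cong (f zero +_) (Σℚ≡sum (λ i → f (suc i)))

  Σℚ-cong : ∀ {n} {f g : Fin n → ℚ} → f ≗ g → Σℚ f ≡ Σℚ g
  Σℚ-cong {zero}  f≗g = refl
  Σℚ-cong {suc n} f≗g = cong₂ _+_ (f≗g zero) (Σℚ-cong (λ i → f≗g (suc i)))

  Σℚ-+ : ∀ {n} (f g : Fin n → ℚ) → Σℚ (λ i → f i + g i) ≡ Σℚ f + Σℚ g
  Σℚ-+ f g = begin
    Σℚ (λ i → f i + g i)    ≡⟨ Σℚ≡sum (λ i → f i + g i) ⟩
    sum M (λ i → f i + g i) ≡⟨ ∑-distrib-+ M f g ⟩
    sum M f + sum M g       ≡⟨ cong₂ _+_ (Σℚ≡sum f) (Σℚ≡sum g) ⟨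
    Σℚ f + Σℚ g             ∎
    where
    open ≡-Reasoning
    M = +-0-commutativeMonoid

  Σℚ-zero : ∀ n → Σℚ {n} (λ _ → 0ℚ) ≡ 0ℚ
  Σℚ-zero zero    = refl
  Σℚ-zero (suc n) = trans (+-identityˡ _) (Σℚ-zero n)

  Σℚ-mono-≤ : ∀ {n} {f g : Fin n → ℚ} → (∀ i → f i ≤ g i) → Σℚ f ≤ Σℚ g
  Σℚ-mono-≤ {zero}  f≤g = ≤-refl
  Σℚ-mono-≤ {suc n} f≤g = +-mono-≤ (f≤g zero) (Σℚ-mono-≤ (λ i → f≤g (suc i)))

  Σℚ-mono-≤-≡⇒≗ : ∀ {n} {f g : Fin n → ℚ} → (∀ i → f i ≤ g i) → Σℚ f ≡ Σℚ g → f ≗ g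
  Σℚ-mono-≤-≡⇒≗ {suc n} f≤g eq zero = +-≤-≡⇒≡ˡ (f≤g zero) (Σℚ-mono-≤ (λ i → f≤g (suc i))) eq
  Σℚ-mono-≤-≡⇒≗ {suc n} {f} {g} f≤g eq (suc i) = Σℚ-mono-≤-≡⇒≗ (λ i → f≤g (suc i)) tails-equal i
    where
    tails-equal = +-≤-≡⇒≡ˡ (Σℚ-mono-≤ (λ i → f≤g (suc i))) (f≤g zero)
                    (trans (+-comm (Σℚ (λ i → f (suc i))) (f zero)) (trans eq (+-comm (g zero) _)))

  Σℚ-splitAt : ∀ m {n} (f : Fin (m ℕ.+ n) → ℚ) →
    Σℚ f ≡ Σℚ (λ i → f (i ↑ˡ n)) + Σℚ (λ i → f (m ↑ʳ i))
  Σℚ-splitAt zero    f = sym (+-identityˡ _)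
  Σℚ-splitAt (suc m) f = trans (cong (f zero +_) (Σℚ-splitAt m (λ i → f (suc i))))
                               (sym (+-assoc (f zero) _ _))

  infixl 6 _⊕_ _⊖_

  _⊕_ : ∀ {n} → Point n → Point n → Point n
  (x ⊕ y) i = x i + y i

  _⊖_ : ∀ {n} → Point n → Point n → Point n
  (x ⊖ y) i = x i - y i

  bump : ∀ {n} → Fin n → ℚ → Point n
  bump j t = updateAt (λ _ → 0ℚ) j (λ _ → t)

  bump-self : ∀ {n} (j : Fin n) t → bump j t j ≡ t
  bump-self j t = updateAt-updates j (λ _ → 0ℚ)

  bump-other : ∀ {n} {i j : Fin n} t → i ≢ j → bump j t i ≡ 0ℚ
  bump-other {i = i} {j} t i≢j = updateAt-minimal i j (λ _ → 0ℚ) i≢j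

  dot-cong : ∀ {n} (c : Point n) {x y} → x ≗ y → dot c x ≡ dot c y
  dot-cong c x≗y = Σℚ-cong (λ i → cong (c i *_) (x≗y i))

  dot-zeroʳ : ∀ {n} (c : Point n) → dot c (λ _ → 0ℚ) ≡ 0ℚ
  dot-zeroʳ {n} c = trans (Σℚ-cong (λ i → *-zeroʳ (c i))) (Σℚ-zero n)

  dot-⊕ : ∀ {n} (c x y : Point n) → dot c (x ⊕ y) ≡ dot c x + dot c y
  dot-⊕ c x y = trans (Σℚ-cong (λ i → *-distribˡ-+ (c i) (x i) (y i)))
                      (Σℚ-+ (λ i → c i * x i) (λ i → c i * y i))

  dot-⊖ : ∀ {n} (c x y : Point n) → dot c (x ⊖ y) ≡ dot c x - dot c y
  dot-⊖ c x y = begin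
    dot c (x ⊖ y)                     ≡⟨ solve 2 (λ d e → d := d :+ e :- e) refl (dot c (x ⊖ y)) (dot c y) ⟩
    dot c (x ⊖ y) + dot c y - dot c y ≡⟨ cong (_- dot c y) (dot-⊕ c (x ⊖ y) y) ⟨
    dot c ((x ⊖ y) ⊕ y) - dot c y     ≡⟨ cong (_- dot c y) (dot-cong c x-y+y≗x) ⟩
    dot c x - dot c y                 ∎
    where
    open ≡-Reasoning
    x-y+y≗x : (x ⊖ y) ⊕ y ≗ x
    x-y+y≗x i = solve 2 (λ a b → a :- b :+ b := a) refl (x i) (y i)

  dot-bump : ∀ {n} (c : Point n) j t → dot c (bump j t) ≡ c j * t
  dot-bump {suc n} c zero    t =
    trans (cong (c zero * t +_) (dot-zeroʳ (λ i → c (suc i)))) (+-identityʳ _)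
  dot-bump {suc n} c (suc j) t =
    trans (cong₂ _+_ (*-zeroʳ (c zero)) (dot-bump (λ i → c (suc i)) j t)) (+-identityˡ _)

  dot-exchange : ∀ {n} (c x y : Point n) j → (∀ i → i ≢ j → x i ≡ y i) →
    dot c x + c j * y j ≡ dot c y + c j * x j
  dot-exchange {suc n} c x y zero x≈y =
    trans (cong (λ R → c zero * x zero + R + c zero * y zero)
                (Σℚ-cong (λ i → cong (c (suc i) *_) (x≈y (suc i) λ ()))))
          (solve 4 (λ a b d R → a :* b :+ R :+ a :* d := a :* d :+ R :+ a :* b) refl
                 (c zero) (x zero) (y zero) (dot (λ i → c (suc i)) (λ i → y (suc i))))
  dot-exchange {suc n} c x y (suc j) x≈y = begin
    c zero * x zero + D x + c (suc j) * y (suc j)   ≡⟨ +-assoc (c zero * x zero) _ _ ⟩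
    c zero * x zero + (D x + c (suc j) * y (suc j)) ≡⟨ cong₂ _+_ (cong (c zero *_) (x≈y zero λ ())) tails ⟩
    c zero * y zero + (D y + c (suc j) * x (suc j)) ≡⟨ +-assoc (c zero * y zero) _ _ ⟨
    c zero * y zero + D y + c (suc j) * x (suc j)   ∎
    where
    open ≡-Reasoning
    D : Point (suc n) → ℚ
    D z = dot (λ i → c (suc i)) (λ i → z (suc i))
    tails : D x + c (suc j) * y (suc j) ≡ D y + c (suc j) * x (suc j)
    tails = dot-exchange (λ i → c (suc i)) (λ i → x (suc i)) (λ i → y (suc i)) j
              (λ i i≢j → x≈y (suc i) (i≢j ∘ suc-injective))

  dot-≤-exchange : ∀ {n} (c x y : Point n) j → (∀ i → i ≢ j → x i ≡ y i) →
    c j * x j ≤ c j * y j → dot c x ≤ dot c y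
  dot-≤-exchange c x y j x≈y cx≤cy = +-cancelˡ-≤ (c j * y j) (begin
    c j * y j + dot c x ≡⟨ +-comm (c j * y j) (dot c x) ⟩
    dot c x + c j * y j ≡⟨ dot-exchange c x y j x≈y ⟩
    dot c y + c j * x j ≤⟨ +-monoʳ-≤ (dot c y) cx≤cy ⟩
    dot c y + c j * y j ≡⟨ +-comm (dot c y) (c j * y j) ⟩
    c j * y j + dot c y ∎)
    where open ≤-Reasoning

  dot-≤-exchange⁻ : ∀ {n} (c x y : Point n) j → (∀ i → i ≢ j → x i ≡ y i) →
    dot c x ≤ dot c y → c j * x j ≤ c j * y j
  dot-≤-exchange⁻ c x y j x≈y x≤y = +-cancelˡ-≤ (dot c y) (begin
    dot c y + c j * x j ≡⟨ dot-exchange c x y j x≈y ⟨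
    dot c x + c j * y j ≤⟨ +-monoˡ-≤ (c j * y j) x≤y ⟩
    dot c y + c j * y j ∎)
    where open ≤-Reasoning

  Between : ℚ → ℚ → ℚ → Set
  Between p q x = ∃[ t ] 0ℚ ≤ t × t ≤ 1ℚ × x ≡ t * p + (1ℚ - t) * q

  1-t∈[0,1] : ∀ {t} → 0ℚ ≤ t → t ≤ 1ℚ → 0ℚ ≤ 1ℚ - t × 1ℚ - t ≤ 1ℚ
  1-t∈[0,1] 0≤t t≤1 = p≤q⇒0≤q-p t≤1 , +-monoʳ-≤ 1ℚ (neg-antimono-≤ 0≤t)

  convex-flip : ∀ t p q → t * p + (1ℚ - t) * q ≡ (1ℚ - t) * q + (1ℚ - (1ℚ - t)) * p
  convex-flip = solve 3 (λ t p q → t :* p :+ (con 1ℚ :- t) :* q :=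
                                   (con 1ℚ :- t) :* q :+ (con 1ℚ :- (con 1ℚ :- t)) :* p) refl

  Between-sym : ∀ {p q x} → Between p q x → Between q p x
  Between-sym {p} {q} (t , 0≤t , t≤1 , x≡) =
    let 0≤1-t , 1-t≤1 = 1-t∈[0,1] 0≤t t≤1 in 1ℚ - t , 0≤1-t , 1-t≤1 , trans x≡ (convex-flip t p q)

  between : ∀ {p q x} → q ≤ x → x ≤ p → q < p → Between p q x
  between {p} {q} {x} q≤x x≤p q<p = t , 0≤t , t≤1 , x≡
    where
    instance
      p-q-positive : Positive (p - q)
      p-q-positive = positive (p<q⇒0<q-p q<p)
    i = (1/ (p - q)) {{pos⇒nonZero (p - q)}}
    0≤i : 0ℚ ≤ i
    0≤i = <⇒≤ (positive⁻¹ i {{1/pos⇒pos (p - q)}})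
    t = (x - q) * i
    0≤t : 0ℚ ≤ t
    0≤t = ≤-trans (≤-reflexive (sym (*-zeroˡ i))) (*-monoʳ-≤-nonNeg i {{nonNegative 0≤i}} (p≤q⇒0≤q-p q≤x))
    t≤1 : t ≤ 1ℚ
    t≤1 = ≤-trans (*-monoʳ-≤-nonNeg i {{nonNegative 0≤i}} (+-monoˡ-≤ (- q) x≤p))
                  (≤-reflexive (*-inverseʳ (p - q) {{pos⇒nonZero (p - q)}}))
    x≡ : x ≡ t * p + (1ℚ - t) * q
    x≡ = begin
      x                           ≡⟨ solve 2 (λ x q → x := q :+ (x :- q) :* con 1ℚ) refl x q ⟩
      q + (x - q) * 1ℚ            ≡⟨ cong (λ z → q + (x - q) * z) (*-inverseˡ (p - q) {{pos⇒nonZero (p - q)}}) ⟨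
      q + (x - q) * (i * (p - q)) ≡⟨ solve 4 (λ x q p i → q :+ (x :- q) :* (i :* (p :- q)) :=
                                          ((x :- q) :* i) :* p :+ (con 1ℚ :- (x :- q) :* i) :* q) refl x q p i ⟩
      t * p + (1ℚ - t) * q        ∎
      where open ≡-Reasoning

  OnSegment-sym : ∀ {n} {u v x : Point n} → OnSegment u v x → OnSegment v u x
  OnSegment-sym {u = u} {v} (t , 0≤t , t≤1 , x≡) =
    let 0≤1-t , 1-t≤1 = 1-t∈[0,1] 0≤t t≤1 in
    1ℚ - t , 0≤1-t , 1-t≤1 , λ i → trans (x≡ i) (convex-flip t (u i) (v i))

  Between⇒OnSegment : ∀ {n} {u v x : Point n} {j} →
    (∀ i → i ≢ j → u i ≡ v i) → (∀ i → i ≢ j → x i ≡ v i) → Between (u j) (v j) (x j) →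
    OnSegment u v x
  Between⇒OnSegment {u = u} {v} {x} {j} u≈v x≈v (t , 0≤t , t≤1 , xj≡) = t , 0≤t , t≤1 , coordinate
    where
    coordinate : ∀ i → x i ≡ t * u i + (1ℚ - t) * v i
    coordinate i with i ≟ᶠ j
    ... | yes refl = xj≡
    ... | no i≢j   = begin
      x i                       ≡⟨ x≈v i i≢j ⟩
      v i                       ≡⟨ solve 2 (λ t v → v := t :* v :+ (con 1ℚ :- t) :* v) refl t (v i) ⟩
      t * v i + (1ℚ - t) * v i  ≡⟨ cong (λ z → t * z + (1ℚ - t) * v i) (u≈v i i≢j) ⟨
      t * u i + (1ℚ - t) * v i  ∎
      where open ≡-Reasoning

  vertex-not-midpoint : ∀ {n} {P : Point n → Set} {u e} → IsVertex P u → P (u ⊕ e) → P (u ⊖ e) →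
    ∀ i → e i ≡ 0ℚ
  vertex-not-midpoint {u = u} {e} (_ , c , δ , valid , cu≡δ , face) u+e∈P u-e∈P i = begin
    e i             ≡⟨ solve 2 (λ u e → e := u :+ e :- u) refl (u i) (e i) ⟩
    u i + e i - u i ≡⟨ cong (_- u i) (face (u ⊕ e) u+e∈P on-face i) ⟩
    u i - u i       ≡⟨ +-inverseʳ (u i) ⟩
    0ℚ              ∎
    where
    open ≡-Reasoning
    midpoint : (u ⊕ e) ⊕ (u ⊖ e) ≗ u ⊕ u
    midpoint i = solve 2 (λ u e → (u :+ e) :+ (u :- e) := u :+ u) refl (u i) (e i)
    on-face : dot c (u ⊕ e) ≡ δ
    on-face = +-≤-≡⇒≡ˡ (valid _ u+e∈P) (valid _ u-e∈P) (begin
      dot c (u ⊕ e) + dot c (u ⊖ e) ≡⟨ dot-⊕ c (u ⊕ e) (u ⊖ e) ⟨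
      dot c ((u ⊕ e) ⊕ (u ⊖ e))     ≡⟨ dot-cong c midpoint ⟩
      dot c (u ⊕ u)                 ≡⟨ dot-⊕ c u u ⟩
      dot c u + dot c u             ≡⟨ cong₂ _+_ cu≡δ cu≡δ ⟩
      δ + δ                         ∎)

  IsEdge-sym : ∀ {n} {P : Point n → Set} {u v} → IsEdge P u v → IsEdge P v u
  IsEdge-sym (u-vertex , v-vertex , u≉v , c , δ , valid , cu≡δ , cv≡δ , face) =
    v-vertex , u-vertex , (λ v≗u → u≉v (λ i → sym (v≗u i))) , c , δ , valid , cv≡δ , cu≡δ ,
    λ x x∈P cx≡δ → OnSegment-sym (face x x∈P cx≡δ)

  WalkWithin : ∀ {n} → (Point n → Set) → ℕ → Point n → Point n → Set
  WalkWithin P k u v = ∃[ m ] m ℕ.≤ k × Walk P u v m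

  module _ {n} {P : Point n → Set} where

    infixr 5 _◅_

    _◅_ : ∀ {u w v k} → IsEdge P u w → WalkWithin P k w v → WalkWithin P (suc k) u v
    e ◅ (m , m≤k , walk) = suc m , ℕ.s≤s m≤k , step e walk

    WalkWithin-mono : ∀ {u v k l} → k ℕ.≤ l → WalkWithin P k u v → WalkWithin P l u v
    WalkWithin-mono k≤l (m , m≤k , walk) = m , ℕ.≤-trans m≤k k≤l , walk

  module _ {n} {P : Point n → Set} (P-resp : P Respects _≗_) where

    IsVertex-resp : IsVertex P Respects _≗_
    IsVertex-resp u≗v (u∈P , c , δ , valid , cu≡δ , face) =
      P-resp u≗v u∈P , c , δ , valid , trans (sym (dot-cong c u≗v)) cu≡δ ,
      λ x x∈P cx≡δ i → trans (face x x∈P cx≡δ i) (u≗v i)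

    IsEdge-respˡ : ∀ {u u′ v} → u ≗ u′ → IsEdge P u v → IsEdge P u′ v
    IsEdge-respˡ {v = v} u≗u′ (u-vertex , v-vertex , u≉v , c , δ , valid , cu≡δ , cv≡δ , face) =
      IsVertex-resp u≗u′ u-vertex , v-vertex , (λ u′≗v → u≉v (λ i → trans (u≗u′ i) (u′≗v i))) ,
      c , δ , valid , trans (sym (dot-cong c u≗u′)) cu≡δ , cv≡δ , on-segment
      where
      on-segment : ∀ x → P x → dot c x ≡ δ → OnSegment _ v x
      on-segment x x∈P cx≡δ =
        let t , 0≤t , t≤1 , x≡ = face x x∈P cx≡δ in
        t , 0≤t , t≤1 , λ i → trans (x≡ i) (cong (λ z → t * z + (1ℚ - t) * v i) (u≗u′ i))

    Walk-respˡ : ∀ {u u′ v k} → u ≗ u′ → Walk P u′ v k → Walk P u v k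
    Walk-respˡ u≗u′ (stop u′≗v)   = stop (λ i → trans (u≗u′ i) (u′≗v i))
    Walk-respˡ u≗u′ (step e walk) = step (IsEdge-respˡ (λ i → sym (u≗u′ i)) e) walk

    WalkWithin-respˡ : ∀ {u u′ v k} → u ≗ u′ → WalkWithin P k u′ v → WalkWithin P k u v
    WalkWithin-respˡ u≗u′ (m , m≤k , walk) = m , m≤k , Walk-respˡ u≗u′ walk

    Walk-++ : ∀ {u w v k l} → Walk P u w k → Walk P w v l → Walk P u v (k ℕ.+ l)
    Walk-++ (stop u≗w)    walk′ = Walk-respˡ u≗w walk′
    Walk-++ (step e walk) walk′ = step e (Walk-++ walk walk′)

    Walk-reverse : ∀ {u v k} → Walk P u v k → Walk P v u k
    Walk-reverse (stop u≗v) = stop (λ i → sym (u≗v i))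
    Walk-reverse {k = suc k} (step e walk) = subst (Walk P _ _) (ℕ.+-comm k 1)
      (Walk-++ (Walk-reverse walk) (step (IsEdge-sym e) (stop (λ _ → refl))))

    diameter-via-hub : ∀ {k h} → (∀ u → IsVertex P u → WalkWithin P k u h) → DiameterAtMost P (2 ℕ.* k)
    diameter-via-hub {k} to-hub u v u-vertex v-vertex =
      let m , m≤k , walk = to-hub u u-vertex
          m′ , m′≤k , walk′ = to-hub v v-vertex
      in m ℕ.+ m′ , ℕ.+-mono-≤ m≤k (ℕ.≤-trans m′≤k (ℕ.m≤m+n k 0)) , Walk-++ walk (Walk-reverse walk′)

  module _ {n} {P Q : Point n → Set} (P⇔Q : ∀ {x} → P x ⇔ Q x) where

    private
      to : ∀ {x} → P x → Q x
      to = Equivalence.to P⇔Q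
      from : ∀ {x} → Q x → P x
      from = Equivalence.from P⇔Q

    IsVertex-⇔ : ∀ {u} → IsVertex P u → IsVertex Q u
    IsVertex-⇔ (u∈P , c , δ , valid , cu≡δ , face) =
      to u∈P , c , δ , (λ x x∈Q → valid x (from x∈Q)) , cu≡δ , λ x x∈Q → face x (from x∈Q)

    IsEdge-⇔ : ∀ {u v} → IsEdge P u v → IsEdge Q u v
    IsEdge-⇔ (u-vertex , v-vertex , u≉v , c , δ , valid , cu≡δ , cv≡δ , face) =
      IsVertex-⇔ u-vertex , IsVertex-⇔ v-vertex , u≉v , c , δ , (λ x x∈Q → valid x (from x∈Q)) ,
      cu≡δ , cv≡δ , λ x x∈Q → face x (from x∈Q)

    Walk-⇔ : ∀ {u v k} → Walk P u v k → Walk Q u v k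
    Walk-⇔ (stop u≗v)    = stop u≗v
    Walk-⇔ (step e walk) = step (IsEdge-⇔ e) (Walk-⇔ walk)

  DiameterAtMost-⇔ : ∀ {n} {P Q : Point n → Set} {k} → (∀ {x} → P x ⇔ Q x) →
    DiameterAtMost P k → DiameterAtMost Q k
  DiameterAtMost-⇔ P⇔Q diameter u v u-vertex v-vertex =
    let m , m≤k , walk = diameter u v (IsVertex-⇔ (⇔.sym P⇔Q) u-vertex) (IsVertex-⇔ (⇔.sym P⇔Q) v-vertex)
    in m , m≤k , Walk-⇔ P⇔Q walk

  Box : ∀ {n} → Point n → Set
  Box x = ∀ i → 0ℚ ≤ x i × x i ≤ 1ℚ

  bit : Bool → ℚ
  bit true  = 1ℚ
  bit false = 0ℚ

  χ : ∀ {n} → Subset n → Point n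
  χ s i = bit (lookup s i)

  χ-box : ∀ {n} (s : Subset n) → Box (χ s)
  χ-box s i with lookup s i
  ... | true  = nonNegative⁻¹ 1ℚ , ≤-refl
  ... | false = ≤-refl , nonNegative⁻¹ 1ℚ

  χ-∈ : ∀ {n} {s : Subset n} {i} → i ∈ s → χ s i ≡ 1ℚ
  χ-∈ i∈s = cong bit ([]=⇒lookup i∈s)

  χ-update : ∀ {n} (s : Subset n) i b → χ (s [ i ]≔ b) i ≡ bit b
  χ-update s i b = cong bit (lookup∘update i s b)

  χ-update′ : ∀ {n} (s : Subset n) {i k} b → k ≢ i → χ (s [ i ]≔ b) k ≡ χ s k
  χ-update′ s b k≢i = cong bit (lookup∘update′ k≢i s b)

  removal⊂ : ∀ {n} {s : Subset n} {i} → i ∈ s → s [ i ]≔ outside ⊂ s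
  removal⊂ {s = s} {i} i∈s = ⊆s , i , i∈s , i∉
    where
    i∉ : i ∉ s [ i ]≔ outside
    i∉ i∈ with trans (sym ([]=⇒lookup i∈)) (lookup∘update i s outside)
    ... | ()
    ⊆s : s [ i ]≔ outside ⊆ s
    ⊆s {k} k∈ with k ≟ᶠ i
    ... | yes refl = contradiction k∈ i∉
    ... | no k≢i   = lookup⇒[]= k s (trans (sym (lookup∘update′ k≢i s outside)) ([]=⇒lookup k∈))

  -- A pattern σ : Fin n → Maybe Bool fixes coordinate i to a bit (σ i = just b) or leaves it
  -- free (σ i = nothing).  The inequality  Σ coeff (σ i) · x i ≤ Σ level (σ i)  is valid on the
  -- cube, and its face consists of the points that fit the pattern.
  coeff : Maybe Bool → ℚ
  coeff nothing      = 0ℚ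
  coeff (just true)  = 1ℚ
  coeff (just false) = - 1ℚ

  level : Maybe Bool → ℚ
  level nothing  = 0ℚ
  level (just b) = bit b

  Fits : Maybe Bool → ℚ → Set
  Fits m x = All (λ b → x ≡ bit b) m

  coeff-≤ : ∀ m {x} → 0ℚ ≤ x → x ≤ 1ℚ → coeff m * x ≤ level m
  coeff-≤ nothing      {x} _   _   = ≤-reflexive (*-zeroˡ x)
  coeff-≤ (just true)  {x} _   x≤1 = ≤-trans (≤-reflexive (*-identityˡ x)) x≤1
  coeff-≤ (just false) {x} 0≤x _   =
    ≤-trans (≤-reflexive (solve 1 (λ x → (:- con 1ℚ) :* x := :- x) refl x)) (neg-antimono-≤ 0≤x)

  coeff-fits : ∀ m {x} → Fits m x → coeff m * x ≡ level m
  coeff-fits nothing      {x} nothing     = *-zeroˡ x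
  coeff-fits (just true)      (just refl) = refl
  coeff-fits (just false)     (just refl) = refl

  coeff-fits⁻ : ∀ m {x} → coeff m * x ≡ level m → Fits m x
  coeff-fits⁻ nothing          _  = nothing
  coeff-fits⁻ (just true)  {x} eq = just (trans (sym (*-identityˡ x)) eq)
  coeff-fits⁻ (just false) {x} eq =
    just (trans (solve 1 (λ x → x := :- ((:- con 1ℚ) :* x)) refl x) (cong -_ eq))

  face-attained : ∀ {n} (σ : Fin n → Maybe Bool) {x} → (∀ i → Fits (σ i) (x i)) →
    dot (coeff ∘ σ) x ≡ Σℚ (level ∘ σ)
  face-attained σ fits = Σℚ-cong (λ i → coeff-fits (σ i) (fits i))

  freeAt : ∀ {n} → Fin n → Subset n → Fin n → Maybe Bool
  freeAt j s = updateAt (just ∘ lookup s) j (λ _ → nothing)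

  fits-freeAt : ∀ {n} {j} {s : Subset n} {x : Point n} → (∀ i → i ≢ j → x i ≡ χ s i) →
    ∀ i → Fits (freeAt j s i) (x i)
  fits-freeAt {j = j} {s} {x} x≈χs i with i ≟ᶠ j
  ... | yes refl = subst (λ m → Fits m (x i)) (sym (updateAt-updates j (just ∘ lookup s))) nothing
  ... | no i≢j   = subst (λ m → Fits m (x i)) (sym (updateAt-minimal i j (just ∘ lookup s) i≢j))
                         (just (x≈χs i i≢j))

  fits-freeAt⁻ : ∀ {n} {j} {s : Subset n} {x : Point n} → (∀ i → Fits (freeAt j s i) (x i)) →
    ∀ i → i ≢ j → x i ≡ χ s i
  fits-freeAt⁻ {j = j} {s} {x} fits i i≢j =
    drop-just (subst (λ m → Fits m (x i)) (updateAt-minimal i j (just ∘ lookup s) i≢j) (fits i))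

  module Cube {n} {P : Point n → Set} (P⊆Box : ∀ {x} → P x → Box x) where

    face-valid : (σ : Fin n → Maybe Bool) → Valid P (coeff ∘ σ) (Σℚ (level ∘ σ))
    face-valid σ x x∈P = Σℚ-mono-≤ (λ i → coeff-≤ (σ i) (P⊆Box x∈P i .proj₁) (P⊆Box x∈P i .proj₂))

    face-fits : (σ : Fin n → Maybe Bool) {x : Point n} → P x → dot (coeff ∘ σ) x ≡ Σℚ (level ∘ σ) →
      ∀ i → Fits (σ i) (x i)
    face-fits σ x∈P eq i = coeff-fits⁻ (σ i)
      (Σℚ-mono-≤-≡⇒≗ (λ i → coeff-≤ (σ i) (P⊆Box x∈P i .proj₁) (P⊆Box x∈P i .proj₂)) eq i)

    χ-vertex : ∀ {s} → P (χ s) → IsVertex P (χ s)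
    χ-vertex {s} χs∈P =
      χs∈P , coeff ∘ σ , Σℚ (level ∘ σ) , face-valid σ , face-attained σ {χ s} (λ i → just refl) ,
      λ x x∈P eq i → drop-just (face-fits σ x∈P eq i)
      where
      σ : Fin n → Maybe Bool
      σ = just ∘ lookup s

    cube-edge : ∀ {u s j} → IsVertex P u → P (χ s) →
      (∀ i → i ≢ j → u i ≡ χ s i) → u j ≢ χ s j →
      (∀ x → P x → (∀ i → i ≢ j → x i ≡ χ s i) → Between (u j) (χ s j) (x j)) →
      IsEdge P u (χ s)
    cube-edge {u} {s} {j} u-vertex χs∈P u≈χs uj≢ between-ends =
      u-vertex , χ-vertex {s} χs∈P , (λ u≗χs → uj≢ (u≗χs j)) ,
      coeff ∘ σ , Σℚ (level ∘ σ) , face-valid σ ,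
      face-attained σ {u} (fits-freeAt {s = s} u≈χs) ,
      face-attained σ {χ s} (fits-freeAt {s = s} (λ _ _ → refl)) ,
      λ x x∈P eq → let x≈χs = fits-freeAt⁻ {s = s} {x} (face-fits σ x∈P eq) in
                   Between⇒OnSegment u≈χs x≈χs (between-ends x x∈P x≈χs)
      where
      σ : Fin n → Maybe Bool
      σ = freeAt j s

    removal-edge : ∀ {s i} → i ∈ s → P (χ s) → P (χ (s [ i ]≔ outside)) →
      IsEdge P (χ s) (χ (s [ i ]≔ outside))
    removal-edge {s} {i} i∈s χs∈P χs′∈P =
      cube-edge {s = s [ i ]≔ outside} (χ-vertex {s} χs∈P) χs′∈P (λ k k≢i → sym (χ-update′ s outside k≢i))
        (λ eq → 1≢0 (trans (sym (χ-∈ i∈s)) (trans eq (χ-update s i outside))))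
        (λ x x∈P _ → subst₂ (λ p q → Between p q (x i)) (sym (χ-∈ i∈s)) (sym (χ-update s i outside))
                       (between (P⊆Box x∈P i .proj₁) (P⊆Box x∈P i .proj₂) (positive⁻¹ 1ℚ)))

    cube-walk : (∀ s → P (χ s) → Nonempty s → ∃[ i ] i ∈ s × P (χ (s [ i ]≔ outside))) →
      ∀ s → P (χ s) → WalkWithin P ∣ s ∣ˢ (χ s) (χ ∅)
    cube-walk removable s χs∈P = walk s χs∈P (<-wellFounded ∣ s ∣ˢ)
      where
      walk : ∀ s → P (χ s) → Acc ℕ._<_ ∣ s ∣ˢ → WalkWithin P ∣ s ∣ˢ (χ s) (χ ∅)
      walk s χs∈P (acc smaller) with nonempty? s
      ... | no empty = 0 , ℕ.z≤n , stop (λ i → cong (λ s → χ s i) (Empty-unique empty))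
      ... | yes nonempty =
        let i , i∈s , χs′∈P = removable s χs∈P nonempty
            shrinks : ∣ s [ i ]≔ outside ∣ˢ ℕ.< ∣ s ∣ˢ
            shrinks = p⊂q⇒∣p∣<∣q∣ (removal⊂ i∈s)
        in WalkWithin-mono shrinks
             (removal-edge i∈s χs∈P χs′∈P ◅ walk (s [ i ]≔ outside) χs′∈P (smaller shrinks))

  Fractional : ℚ → Set
  Fractional x = 0ℚ < x × x < 1ℚ

  fractional? : ∀ x → Dec (Fractional x)
  fractional? x = 0ℚ <? x ×-dec x <? 1ℚ

  ⌊_⌋ : ∀ {n} → Point n → Subset n
  ⌊ u ⌋ = tabulate (λ i → does (1ℚ ≤? u i))

  χ⌊⌋ : ∀ {n} {u : Point n} {i} → 0ℚ ≤ u i × u i ≤ 1ℚ → ¬ Fractional (u i) → χ ⌊ u ⌋ i ≡ u i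
  χ⌊⌋ {u = u} {i} (0≤uᵢ , uᵢ≤1) not-fractional =
    trans (cong bit (lookup∘tabulate (λ i → does (1ℚ ≤? u i)) i)) (rounds (1ℚ ≤? u i))
    where
    rounds : (1≤?uᵢ : Dec (1ℚ ≤ u i)) → bit (does 1≤?uᵢ) ≡ u i
    rounds (yes 1≤uᵢ) = ≤-antisym 1≤uᵢ uᵢ≤1
    rounds (no  1≰uᵢ) = ≤-antisym 0≤uᵢ (≮⇒≥ (λ 0<uᵢ → not-fractional (0<uᵢ , ≰⇒> 1≰uᵢ)))

  margin : ℚ → ℚ
  margin x = x ⊓ (1ℚ - x)

  margin-nonneg : ∀ {x} → 0ℚ ≤ x × x ≤ 1ℚ → 0ℚ ≤ margin x
  margin-nonneg (0≤x , x≤1) = ⊓-glb 0≤x (p≤q⇒0≤q-p x≤1)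

  margin-pos : ∀ {x} → Fractional x → 0ℚ < margin x
  margin-pos (0<x , x<1) = ⊓-glb-< 0<x (p<q⇒0<q-p x<1)

  +-margin-∈[0,1] : ∀ x {e} → ∣ e ∣ ≤ margin x → 0ℚ ≤ x + e × x + e ≤ 1ℚ
  +-margin-∈[0,1] x {e} ∣e∣≤m = lower , upper
    where
    open ≤-Reasoning
    lower : 0ℚ ≤ x + e
    lower = begin
      0ℚ          ≡⟨ +-inverseʳ x ⟨
      x - x       ≤⟨ +-monoʳ-≤ x (neg-antimono-≤ (p≤q⊓r⇒p≤q x (1ℚ - x) ∣e∣≤m)) ⟩
      x - ∣ e ∣   ≤⟨ +-monoʳ-≤ x (-∣p∣≤p e) ⟩
      x + e       ∎
    upper : x + e ≤ 1ℚ
    upper = begin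
      x + e        ≤⟨ +-monoʳ-≤ x (p≤∣p∣ e) ⟩
      x + ∣ e ∣    ≤⟨ +-monoʳ-≤ x (p≤q⊓r⇒p≤r x (1ℚ - x) ∣e∣≤m) ⟩
      x + (1ℚ - x) ≡⟨ solve 1 (λ x → x :+ (con 1ℚ :- x) := con 1ℚ) refl x ⟩
      1ℚ           ∎

  downhill-rounding : ∀ {α x} → α ≢ 0ℚ → Fractional x →
    ∃[ b ] α * bit b ≤ α * x × bit b ≢ x ×
           (∀ y → 0ℚ ≤ y → y ≤ 1ℚ → α * y ≤ α * x → Between x (bit b) y)
  downhill-rounding {α} {x} α≢0 (0<x , x<1) with α <? 0ℚ
  ... | yes α<0 =
    true , *-monoˡ-≤-nonPos α {{nonPositive (<⇒≤ α<0)}} (<⇒≤ x<1) , (λ 1≡x → <⇒≢ x<1 (sym 1≡x)) ,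
    λ y _ y≤1 αy≤αx → Between-sym (between (*-cancelˡ-≤-neg α {{negative α<0}} αy≤αx) y≤1 x<1)
  ... | no  α≮0 =
    false , *-monoˡ-≤-nonNeg α {{nonNegative (≮⇒≥ α≮0)}} (<⇒≤ 0<x) , (λ 0≡x → <⇒≢ 0<x 0≡x) ,
    λ y 0≤y _ αy≤αx → between 0≤y (*-cancelˡ-≤-pos α {{positive 0<α}} αy≤αx) 0<x
    where
    0<α : 0ℚ < α
    0<α = ≤∧≢⇒< (≮⇒≥ α≮0) (λ 0≡α → α≢0 (sym 0≡α))

  -- Knapsack polytopes

  Knapsack : ∀ {n} → Point n → ℚ → Point n → Set
  Knapsack a r x = Box x × dot a x ≤ r

  module _ {n} (a : Point n) (r : ℚ) where

    private
      K : Point n → Set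
      K = Knapsack a r

    open Cube {P = K} proj₁

    Knapsack-resp : K Respects _≗_
    Knapsack-resp x≗y (x∈box , ax≤r) =
      (λ i → subst (λ z → 0ℚ ≤ z × z ≤ 1ℚ) (x≗y i) (x∈box i)) , subst (_≤ r) (dot-cong a x≗y) ax≤r

    slack-nonneg : ∀ {x} → K x → 0ℚ ≤ r - dot a x
    slack-nonneg x∈K = p≤q⇒0≤q-p (x∈K .proj₂)

    vertex-perturbation-zero : ∀ {u e} → IsVertex K u → (∀ i → ∣ e i ∣ ≤ margin (u i)) →
      ∣ dot a e ∣ ≤ r - dot a u → ∀ i → e i ≡ 0ℚ
    vertex-perturbation-zero {u} {e} u-vertex ∣e∣≤m ∣ae∣≤slack = vertex-not-midpoint u-vertex u+e∈K u-e∈K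
      where
      u+e∈K : K (u ⊕ e)
      u+e∈K = (λ i → +-margin-∈[0,1] (u i) (∣e∣≤m i)) ,
              subst (_≤ r) (sym (dot-⊕ a u e)) (∣q∣≤r-p⇒p+q≤r ∣ae∣≤slack)
      u-e∈K : K (u ⊖ e)
      u-e∈K = (λ i → +-margin-∈[0,1] (u i) (subst (_≤ margin (u i)) (sym (∣-p∣≡∣p∣ (e i))) (∣e∣≤m i))) ,
              subst (_≤ r) (sym (dot-⊖ a u e))
                (∣q∣≤r-p⇒p+q≤r (subst (_≤ r - dot a u) (sym (∣-p∣≡∣p∣ (dot a e))) ∣ae∣≤slack))

    no-coordinate-perturbation : ∀ {u} → IsVertex K u → ∀ j {t} → 0ℚ < t → t ≤ margin (u j) →
      ∣ a j * t ∣ ≤ r - dot a u → ⊥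
    no-coordinate-perturbation {u} u-vertex j {t} 0<t t≤m ∣ajt∣≤slack =
      <⇒≢ 0<t (sym (trans (sym (bump-self j t)) (vertex-perturbation-zero u-vertex bounded slack j)))
      where
      bounded : ∀ i → ∣ bump j t i ∣ ≤ margin (u i)
      bounded i with i ≟ᶠ j
      ... | yes refl = subst (λ z → ∣ z ∣ ≤ margin (u i)) (sym (bump-self i t))
                         (subst (_≤ margin (u i)) (sym (0≤p⇒∣p∣≡p (<⇒≤ 0<t))) t≤m)
      ... | no i≢j   = subst (λ z → ∣ z ∣ ≤ margin (u i)) (sym (bump-other t i≢j))
                         (margin-nonneg (u-vertex .proj₁ .proj₁ i))
      slack : ∣ dot a (bump j t) ∣ ≤ r - dot a u
      slack = subst (λ z → ∣ z ∣ ≤ r - dot a u) (sym (dot-bump a j t)) ∣ajt∣≤slack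

    no-two-coordinate-perturbation : ∀ {u j k} → IsVertex K u → j ≢ k → ∀ {p q} → p ≢ 0ℚ →
      ∣ p ∣ ≤ margin (u j) → ∣ q ∣ ≤ margin (u k) → a j * p + a k * q ≡ 0ℚ → ⊥
    no-two-coordinate-perturbation {u} {j} {k} u-vertex j≢k {p} {q} p≢0 ∣p∣≤m ∣q∣≤m ap+aq≡0 =
      p≢0 (trans (sym e-j) (vertex-perturbation-zero u-vertex bounded slack j))
      where
      e : Point n
      e = bump j p ⊕ bump k q
      e-j : e j ≡ p
      e-j = trans (cong₂ _+_ (bump-self j p) (bump-other q j≢k)) (+-identityʳ p)
      bounded : ∀ i → ∣ e i ∣ ≤ margin (u i)
      bounded i with i ≟ᶠ j | i ≟ᶠ k
      ... | yes refl | _        = subst (λ z → ∣ z ∣ ≤ margin (u i)) (sym e-j) ∣p∣≤m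
      ... | no i≢j   | yes refl = subst (λ z → ∣ z ∣ ≤ margin (u i))
                                   (sym (trans (cong₂ _+_ (bump-other p i≢j) (bump-self i q)) (+-identityˡ q))) ∣q∣≤m
      ... | no i≢j   | no i≢k   = subst (λ z → ∣ z ∣ ≤ margin (u i))
                                   (sym (trans (cong₂ _+_ (bump-other p i≢j) (bump-other q i≢k)) (+-identityˡ 0ℚ)))
                                   (margin-nonneg (u-vertex .proj₁ .proj₁ i))
      ae≡0 : dot a e ≡ 0ℚ
      ae≡0 = trans (dot-⊕ a (bump j p) (bump k q)) (trans (cong₂ _+_ (dot-bump a j p) (dot-bump a k q)) ap+aq≡0)
      slack : ∣ dot a e ∣ ≤ r - dot a u
      slack = subst (λ z → ∣ z ∣ ≤ r - dot a u) (sym ae≡0) (slack-nonneg (u-vertex .proj₁))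

    fractional⇒coeff≢0 : ∀ {u j} → IsVertex K u → Fractional (u j) → a j ≢ 0ℚ
    fractional⇒coeff≢0 {u} {j} u-vertex frac aj≡0 =
      no-coordinate-perturbation u-vertex j (margin-pos frac) ≤-refl
        (subst (λ z → ∣ z * margin (u j) ∣ ≤ r - dot a u) (sym aj≡0)
          (subst (λ z → ∣ z ∣ ≤ r - dot a u) (sym (*-zeroˡ (margin (u j)))) (slack-nonneg (u-vertex .proj₁))))

    fractional⇒tight : ∀ {u j} → IsVertex K u → Fractional (u j) → dot a u ≡ r
    fractional⇒tight {u} {j} u-vertex frac = ≤-antisym (u-vertex .proj₁ .proj₂) (≮⇒≥ slack⇒⊥)
      where
      slack⇒⊥ : ¬ dot a u < r
      slack⇒⊥ au<r =
        let m = margin (u j) ; slack = r - dot a u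
            t , 0<t , t≤ε , small = small-multiplier (⊓-glb-< (margin-pos frac) (p<q⇒0<q-p au<r)) ∣ a j ∣
        in no-coordinate-perturbation u-vertex j 0<t (≤-trans t≤ε (p⊓q≤p m slack))
             (≤-trans (small (a j) ≤-refl) (p⊓q≤q m slack))

    fractional-unique : ∀ {u j k} → IsVertex K u → Fractional (u j) → Fractional (u k) → j ≡ k
    fractional-unique {u} {j} {k} u-vertex frac-j frac-k with j ≟ᶠ k
    ... | yes j≡k = j≡k
    ... | no  j≢k = ⊥-elim $
      let mⱼ = margin (u j) ; mₖ = margin (u k)
          t , 0<t , _ , small = small-multiplier (⊓-glb-< (margin-pos frac-j) (margin-pos frac-k)) (∣ a j ∣ ⊔ ∣ a k ∣)
      in no-two-coordinate-perturbation u-vertex j≢k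
           (λ akt≡0 → fractional⇒coeff≢0 u-vertex frac-k (*-≡0-pos 0<t akt≡0))
           (≤-trans (small (a k) (p≤q⊔p ∣ a j ∣ ∣ a k ∣)) (p⊓q≤p mⱼ mₖ))
           (≤-trans (≤-reflexive (∣-p∣≡∣p∣ (a j * t))) (≤-trans (small (a j) (p≤p⊔q ∣ a j ∣ ∣ a k ∣)) (p⊓q≤q mⱼ mₖ)))
           (solve 3 (λ α γ t → α :* (γ :* t) :+ γ :* (:- (α :* t)) := con 0ℚ) refl (a j) (a k) t)

    removable : 0ℚ ≤ r → ∀ s → K (χ s) → Nonempty s → ∃[ i ] i ∈ s × K (χ (s [ i ]≔ outside))
    removable 0≤r s χs∈K (i₀ , i₀∈s) with any? (λ i → i ∈? s ×-dec 0ℚ ≤? a i)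
    ... | yes (i , i∈s , 0≤aᵢ) =
      i , i∈s , χ-box (s [ i ]≔ outside) ,
      ≤-trans (dot-≤-exchange a (χ (s [ i ]≔ outside)) (χ s) i (λ k k≢i → χ-update′ s outside k≢i) aᵢ0≤aᵢ1)
              (χs∈K .proj₂)
      where
      aᵢ0≤aᵢ1 : a i * χ (s [ i ]≔ outside) i ≤ a i * χ s i
      aᵢ0≤aᵢ1 = subst₂ (λ p q → a i * p ≤ a i * q) (sym (χ-update s i outside)) (sym (χ-∈ i∈s))
                  (*-monoˡ-≤-nonNeg (a i) {{nonNegative 0≤aᵢ}} (nonNegative⁻¹ 1ℚ))
    ... | no none =
      i₀ , i₀∈s , χ-box (s [ i₀ ]≔ outside) , ≤-trans (≤-trans (Σℚ-mono-≤ term≤0) (≤-reflexive (Σℚ-zero n))) 0≤r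
      where
      term≤0 : ∀ k → a k * χ (s [ i₀ ]≔ outside) k ≤ 0ℚ
      term≤0 k with lookup (s [ i₀ ]≔ outside) k in k∈?
      ... | false = ≤-reflexive (*-zeroʳ (a k))
      ... | true  = ≤-trans (≤-reflexive (*-identityʳ (a k)))
                      (<⇒≤ (≰⇒> λ 0≤aₖ → none (k , removal⊂ i₀∈s .proj₁ (lookup⇒[]= k _ k∈?) , 0≤aₖ)))

    rounding-edge-to : ∀ {u j} → IsVertex K u → Fractional (u j) → ∀ b →
      a j * bit b ≤ a j * u j → bit b ≢ u j →
      (∀ y → 0ℚ ≤ y → y ≤ 1ℚ → a j * y ≤ a j * u j → Between (u j) (bit b) y) →
      K (χ (⌊ u ⌋ [ j ]≔ b)) × IsEdge K u (χ (⌊ u ⌋ [ j ]≔ b))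
    rounding-edge-to {u} {j} u-vertex frac b downhill b≢uⱼ between-ends =
      χs∈K , cube-edge {s = s} u-vertex χs∈K u≈χs (λ uⱼ≡ → b≢uⱼ (sym (trans uⱼ≡ χs-j))) ends
      where
      s = ⌊ u ⌋ [ j ]≔ b
      tight : dot a u ≡ r
      tight = fractional⇒tight u-vertex frac
      χs-j : χ s j ≡ bit b
      χs-j = χ-update ⌊ u ⌋ j b
      u≈χs : ∀ i → i ≢ j → u i ≡ χ s i
      u≈χs i i≢j = sym (trans (χ-update′ ⌊ u ⌋ b i≢j)
        (χ⌊⌋ {u = u} {i} (u-vertex .proj₁ .proj₁ i) (λ frac-i → i≢j (fractional-unique u-vertex frac-i frac))))
      χs∈K : K (χ s)
      χs∈K = χ-box s ,
        ≤-trans (dot-≤-exchange a (χ s) u j (λ i i≢j → sym (u≈χs i i≢j))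
                   (subst (λ z → a j * z ≤ a j * u j) (sym χs-j) downhill))
                (≤-reflexive tight)
      ends : ∀ x → K x → (∀ i → i ≢ j → x i ≡ χ s i) → Between (u j) (χ s j) (x j)
      ends x x∈K x≈χs = subst (λ z → Between (u j) z (x j)) (sym χs-j)
        (between-ends (x j) (x∈K .proj₁ j .proj₁) (x∈K .proj₁ j .proj₂)
          (dot-≤-exchange⁻ a x u j (λ i i≢j → trans (x≈χs i i≢j) (sym (u≈χs i i≢j)))
            (≤-trans (x∈K .proj₂) (≤-reflexive (sym tight)))))

    rounding-edge : ∀ {u j} → IsVertex K u → Fractional (u j) → ∃[ s ] K (χ s) × IsEdge K u (χ s)
    rounding-edge {u} {j} u-vertex frac =
      let b , downhill , b≢uⱼ , between-ends = downhill-rounding (fractional⇒coeff≢0 u-vertex frac) frac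
      in ⌊ u ⌋ [ j ]≔ b , rounding-edge-to u-vertex frac b downhill b≢uⱼ between-ends

    walk-to-origin : 0ℚ ≤ r → ¬ K (λ _ → 1ℚ) → ∀ u → IsVertex K u → WalkWithin K n u (χ ∅)
    walk-to-origin 0≤r ones∉K u u-vertex with any? (λ i → fractional? (u i))
    ... | no integral = WalkWithin-respˡ Knapsack-resp u≗χ⌊u⌋
        (WalkWithin-mono (∣p∣≤n ⌊ u ⌋) (cube-walk (removable 0≤r) ⌊ u ⌋ (Knapsack-resp u≗χ⌊u⌋ (u-vertex .proj₁))))
      where
      u≗χ⌊u⌋ : u ≗ χ ⌊ u ⌋
      u≗χ⌊u⌋ i = sym (χ⌊⌋ {u = u} {i} (u-vertex .proj₁ .proj₁ i) (λ frac → integral (i , frac)))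
    ... | yes (j , frac) =
      let s , χs∈K , edge = rounding-edge u-vertex frac
      in WalkWithin-mono (∣s∣<n {s} χs∈K) (edge ◅ cube-walk (removable 0≤r) s χs∈K)
      where
      ∣s∣<n : ∀ {s} → K (χ s) → ∣ s ∣ˢ ℕ.< n
      ∣s∣<n {s} χs∈K = ℕ.≤∧≢⇒< (∣p∣≤n s) λ ∣s∣≡n → ones∉K (Knapsack-resp
        (λ i → trans (cong (λ s → χ s i) (∣p∣≡n⇒p≡⊤ {p = s} ∣s∣≡n)) (cong bit (lookup-replicate i true))) χs∈K)

    knapsack-diameter : 0ℚ ≤ r → ¬ K (λ _ → 1ℚ) → DiameterAtMost K (2 ℕ.* n)
    knapsack-diameter 0≤r ones∉K = diameter-via-hub Knapsack-resp (walk-to-origin 0≤r ones∉K)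

  -- P_b is a knapsack polytope

  Pb-normal : ∀ {d} → (Fin d → ℕ) → Point (d ℕ.+ 2)
  Pb-normal b = (λ i → ℕ→ℚ (b i)) ++ (- β b ∷ (β b + ½) ∷ [])

  Pb-rhs : ∀ {d} → (Fin d → ℕ) → ℚ
  Pb-rhs b = β b + ℤ.+ 1 / 4

  dot-Pb-normal : ∀ {d} (b : Fin d → ℕ) x → dot (Pb-normal b) x ≡
    (Σℚ (λ i → ℕ→ℚ (b i) * x (i ↑ˡ 2)) - β b * x (idx₁ d)) + (β b + ½) * x (idx₂ d)
  dot-Pb-normal {d} b x = begin
    dot (Pb-normal b) x
      ≡⟨ Σℚ-splitAt d (λ i → Pb-normal b i * x i) ⟩
    Σℚ (λ i → Pb-normal b (i ↑ˡ 2) * x (i ↑ˡ 2)) + (Pb-normal b (idx₁ d) * x₁ + (Pb-normal b (idx₂ d) * x₂ + 0ℚ))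
      ≡⟨ cong₂ (λ S c → S + (c * x₁ + (Pb-normal b (idx₂ d) * x₂ + 0ℚ)))
               (Σℚ-cong (λ i → cong (_* x (i ↑ˡ 2)) (lookup-++ˡ bᵢ last₂ i))) (lookup-++ʳ bᵢ last₂ zero) ⟩
    S + (- β b * x₁ + (Pb-normal b (idx₂ d) * x₂ + 0ℚ))
      ≡⟨ cong (λ c → S + (- β b * x₁ + (c * x₂ + 0ℚ))) (lookup-++ʳ bᵢ last₂ (suc zero)) ⟩
    S + (- β b * x₁ + ((β b + ½) * x₂ + 0ℚ))
      ≡⟨ solve 4 (λ S B x₁ x₂ → S :+ ((:- B) :* x₁ :+ ((B :+ con ½) :* x₂ :+ con 0ℚ)) :=
                                 (S :- B :* x₁) :+ (B :+ con ½) :* x₂) refl S (β b) x₁ x₂ ⟩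
    (S - β b * x₁) + (β b + ½) * x₂
      ∎
    where
    open ≡-Reasoning
    bᵢ : Fin d → ℚ
    bᵢ i = ℕ→ℚ (b i)
    last₂ : Fin 2 → ℚ
    last₂ = - β b ∷ (β b + ½) ∷ []
    S = Σℚ (λ i → ℕ→ℚ (b i) * x (i ↑ˡ 2))
    x₁ = x (idx₁ d)
    x₂ = x (idx₂ d)

  Pb⇔Knapsack : ∀ {d} (b : Fin d → ℕ) {x} → Pb b x ⇔ Knapsack (Pb-normal b) (Pb-rhs b) x
  Pb⇔Knapsack b {x} = mk⇔
    (λ (x∈box , ineq) → x∈box , subst (_≤ Pb-rhs b) (sym (dot-Pb-normal b x)) ineq)
    (λ (x∈box , ineq) → x∈box , subst (_≤ Pb-rhs b) (dot-Pb-normal b x) ineq)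

  β-nonneg : ∀ {d} (b : Fin d → ℕ) → 0ℚ ≤ β b
  β-nonneg {d} b = ≤-trans (≤-reflexive (sym (*-zeroʳ ½)))
    (*-monoˡ-≤-nonNeg ½ (≤-trans (≤-reflexive (sym (Σℚ-zero d))) (Σℚ-mono-≤ (λ i → ℕ→ℚ-nonneg (b i)))))
    where
    ℕ→ℚ-nonneg : ∀ k → 0ℚ ≤ ℕ→ℚ k
    ℕ→ℚ-nonneg k = nonNegative⁻¹ (ℕ→ℚ k) {{normalize-nonNeg k 1}}

  0<Pb-rhs : ∀ {d} (b : Fin d → ℕ) → 0ℚ < Pb-rhs b
  0<Pb-rhs b = +-mono-≤-< (β-nonneg b) (positive⁻¹ (ℤ.+ 1 / 4))

  ones∉Pb : ∀ {d} (b : Fin d → ℕ) → ¬ Pb b (λ _ → 1ℚ)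
  ones∉Pb {d} b (_ , ineq) = <-irrefl refl (<-≤-trans (0<Pb-rhs b) rhs≤0)
    where
    S = Σℚ (λ i → ℕ→ℚ (b i))
    value≡2rhs : (Σℚ (λ i → ℕ→ℚ (b i) * 1ℚ) - β b * 1ℚ) + (β b + ½) * 1ℚ ≡ Pb-rhs b + Pb-rhs b
    value≡2rhs = trans (cong (λ z → (z - β b * 1ℚ) + (β b + ½) * 1ℚ) (Σℚ-cong (λ i → *-identityʳ (ℕ→ℚ (b i)))))
      (solve 1 (λ S → (S :- con ½ :* S :* con 1ℚ) :+ (con ½ :* S :+ con ½) :* con 1ℚ :=
                      (con ½ :* S :+ con (ℤ.+ 1 / 4)) :+ (con ½ :* S :+ con (ℤ.+ 1 / 4))) refl S)
    rhs≤0 : Pb-rhs b ≤ 0ℚ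
    rhs≤0 = +-cancelˡ-≤ (Pb-rhs b) (≤-trans (≤-reflexive (sym value≡2rhs))
                                    (≤-trans ineq (≤-reflexive (sym (+-identityʳ (Pb-rhs b))))))

open import Data.Nat using (ℕ; _<_; _*_; _+_)
open import Data.Rational.Properties using (<⇒≤)
open import Function using (_∘_; Equivalence)
import Function.Properties.Equivalence as ⇔
open KnapsackPolytopes
  using (DiameterAtMost-⇔; Pb-normal; Pb-rhs; Pb⇔Knapsack; knapsack-diameter; 0<Pb-rhs; ones∉Pb)

lemma3p13 : (d : ℕ) (b : Fin d → ℕ) → (∀ i → 0 < b i) →
    DiameterAtMost (Pb b) (2 * (d + 2))
lemma3p13 d b _ =
  DiameterAtMost-⇔ (⇔.sym (Pb⇔Knapsack b))
    (knapsack-diameter (Pb-normal b) (Pb-rhs b) (<⇒≤ (0<Pb-rhs b))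
      (ones∉Pb b ∘ Equivalence.from (Pb⇔Knapsack b)))
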